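{- Let $\mathcal C$ be a coherent category with a parametrised natural number object $N$, $X$ an object and $\varphi(x,y)$ a complemented subobject of $X\times N$. If $X\models\top\vdash\exists y\,\varphi(x,y)$, then there exists a morphism $f:X\to N$ such that $X\models\top\vdash\varphi(x,f(x))$, i.e. $\langle\mathrm{id}_X,f\rangle:X\to X\times N$ factors through $\varphi$.
   Context: A coherent category has finite limits, pullback-stable image factorisations and pullback-stable finite unions of subobjects. A parametrised natural number object (PNO) is an object $N$ with $\mathsf 0:1\to N$, $\mathsf s:N\to N$ such that for all $f:A\to X$, $g:X\to X$ there is a unique $r:A\times N\to X$ with $r\circ\langle\mathrm{id},\mathsf 0\rangle=f$ and $r\circ(\mathrm{id}\times\mathsf s)=g\circ r$. A subobject $\varphi$ of $Y$ is complemented if there is $\neg\varphi$ with $\varphi\wedge\neg\varphi=\bot$ and $\varphi\vee\neg\varphi=\top$ in $\mathrm{Sub}(Y)$. Notation: $Y\models\alpha\vdash\beta$ means $\alpha\le\beta$ in $\mathrm{Sub}(Y)$, formulas being read in the internal logic of $\mathcal C$. -}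

module Defs where

open import Level using (Level; _⊔_) renaming (suc to lsuc)
open import Data.Product using (Σ; _,_) renaming (_×_ to _×ᵖ_)
open import Relation.Binary using (Rel; IsEquivalence)

record Category (o ℓ e : Level) : Set (lsuc (o ⊔ ℓ ⊔ e)) where
  infixr 9 _∘_
  infix  4 _≈_
  infixr 5 _⇒_
  field
    Obj       : Set o
    _⇒_       : Obj → Obj → Set ℓ
    _≈_       : ∀ {A B} → Rel (A ⇒ B) e
    id        : ∀ {A} → A ⇒ A
    _∘_       : ∀ {A B C} → B ⇒ C → A ⇒ B → A ⇒ C
    equiv     : ∀ {A B} → IsEquivalence (_≈_ {A} {B})
    ∘-resp-≈  : ∀ {A B C} {f h : B ⇒ C} {g i : A ⇒ B} → f ≈ h → g ≈ i → f ∘ g ≈ h ∘ i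
    assoc     : ∀ {A B C D} {f : A ⇒ B} {g : B ⇒ C} {h : C ⇒ D} → (h ∘ g) ∘ f ≈ h ∘ (g ∘ f)
    identityˡ : ∀ {A B} {f : A ⇒ B} → id ∘ f ≈ f
    identityʳ : ∀ {A B} {f : A ⇒ B} → f ∘ id ≈ f

module Notions {o ℓ e} (𝒞 : Category o ℓ e) where
  open Category 𝒞

  Mono : ∀ {A B} → A ⇒ B → Set (o ⊔ ℓ ⊔ e)
  Mono {A} m = ∀ {Z} (g h : Z ⇒ A) → m ∘ g ≈ m ∘ h → g ≈ h

  record Terminal : Set (o ⊔ ℓ ⊔ e) where
    field
      𝟙      : Obj
      !      : ∀ {A} → A ⇒ 𝟙
      !-uniq : ∀ {A} (f : A ⇒ 𝟙) → f ≈ !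

  record Product (A B : Obj) : Set (o ⊔ ℓ ⊔ e) where
    field
      A×B      : Obj
      π₁       : A×B ⇒ A
      π₂       : A×B ⇒ B
      ⟨_,_⟩    : ∀ {Z} → Z ⇒ A → Z ⇒ B → Z ⇒ A×B
      project₁ : ∀ {Z} {f : Z ⇒ A} {g : Z ⇒ B} → π₁ ∘ ⟨ f , g ⟩ ≈ f
      project₂ : ∀ {Z} {f : Z ⇒ A} {g : Z ⇒ B} → π₂ ∘ ⟨ f , g ⟩ ≈ g
      unique   : ∀ {Z} {f : Z ⇒ A} {g : Z ⇒ B} (h : Z ⇒ A×B) →
                 π₁ ∘ h ≈ f → π₂ ∘ h ≈ g → h ≈ ⟨ f , g ⟩

  IsPullback : ∀ {A B C P} → A ⇒ C → B ⇒ C → P ⇒ A → P ⇒ B → Set (o ⊔ ℓ ⊔ e)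
  IsPullback {A} {B} {C} {P} f g p₁ p₂ =
    (f ∘ p₁ ≈ g ∘ p₂) ×ᵖ
    (∀ {Q} (q₁ : Q ⇒ A) (q₂ : Q ⇒ B) → f ∘ q₁ ≈ g ∘ q₂ →
       Σ (Q ⇒ P) λ u → (p₁ ∘ u ≈ q₁) ×ᵖ (p₂ ∘ u ≈ q₂) ×ᵖ
         (∀ (u' : Q ⇒ P) → p₁ ∘ u' ≈ q₁ → p₂ ∘ u' ≈ q₂ → u' ≈ u))

  record Pullback {A B C} (f : A ⇒ C) (g : B ⇒ C) : Set (o ⊔ ℓ ⊔ e) where
    field
      P          : Obj
      p₁         : P ⇒ A
      p₂         : P ⇒ B
      isPullback : IsPullback f g p₁ p₂

  record Sub (Y : Obj) : Set (o ⊔ ℓ ⊔ e) where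
    field
      dom  : Obj
      arr  : dom ⇒ Y
      mono : Mono arr
  open Sub public

  infix 4 _≤_
  _≤_ : ∀ {Y} → Sub Y → Sub Y → Set (ℓ ⊔ e)
  φ ≤ ψ = Σ (dom φ ⇒ dom ψ) λ h → arr ψ ∘ h ≈ arr φ

  topSub : ∀ Y → Sub Y
  topSub Y = record
    { dom = Y ; arr = id
    ; mono = λ g h eq → IsEquivalence.trans equiv (IsEquivalence.sym equiv identityˡ)
                          (IsEquivalence.trans equiv eq identityˡ) }

  IsTop : ∀ {Y} → Sub Y → Set (ℓ ⊔ e)
  IsTop {Y} φ = topSub Y ≤ φ

  IsBottom : ∀ {Y} → Sub Y → Set (o ⊔ ℓ ⊔ e)
  IsBottom {Y} φ = ∀ (ψ : Sub Y) → φ ≤ ψ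

  IsJoin : ∀ {Y} → Sub Y → Sub Y → Sub Y → Set (o ⊔ ℓ ⊔ e)
  IsJoin {Y} a b j = (a ≤ j) ×ᵖ (b ≤ j) ×ᵖ (∀ (k : Sub Y) → a ≤ k → b ≤ k → j ≤ k)

  IsMeet : ∀ {Y} → Sub Y → Sub Y → Sub Y → Set (o ⊔ ℓ ⊔ e)
  IsMeet {Y} a b m = (m ≤ a) ×ᵖ (m ≤ b) ×ᵖ (∀ (k : Sub Y) → k ≤ a → k ≤ b → k ≤ m)

  Complemented : ∀ {Y} → Sub Y → Set (o ⊔ ℓ ⊔ e)
  Complemented {Y} φ = Σ (Sub Y) λ ψ →
    (Σ (Sub Y) λ μ → IsMeet φ ψ μ ×ᵖ IsBottom μ) ×ᵖ
    (Σ (Sub Y) λ j → IsJoin φ ψ j ×ᵖ IsTop j)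

  IsImage : ∀ {A Y} → A ⇒ Y → Sub Y → Set (o ⊔ ℓ ⊔ e)
  IsImage {A} {Y} f m =
    (Σ (A ⇒ dom m) λ q → arr m ∘ q ≈ f) ×ᵖ
    (∀ (n : Sub Y) → (Σ (A ⇒ dom n) λ q → arr n ∘ q ≈ f) → m ≤ n)

  IsPullbackSub : ∀ {Y Y'} → Y' ⇒ Y → Sub Y → Sub Y' → Set (o ⊔ ℓ ⊔ e)
  IsPullbackSub {Y} {Y'} g m n = Σ (dom n ⇒ dom m) λ q → IsPullback (arr m) g q (arr n)

record CoherentCategory (o ℓ e : Level) : Set (lsuc (o ⊔ ℓ ⊔ e)) where
  field
    cat : Category o ℓ e
  open Category cat public
  open Notions cat public
  field
    terminal : Terminal
    products : ∀ (A B : Obj) → Product A B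
    pullbacks : ∀ {A B C} (f : A ⇒ C) (g : B ⇒ C) → Pullback f g
    image    : ∀ {A Y} (f : A ⇒ Y) → Sub Y
    image-is : ∀ {A Y} (f : A ⇒ Y) → IsImage f (image f)
    image-stable : ∀ {A Y Y' P} (f : A ⇒ Y) (g : Y' ⇒ Y) (m : Sub Y) → IsImage f m →
                   (p₁ : P ⇒ A) (f' : P ⇒ Y') → IsPullback f g p₁ f' →
                   (n : Sub Y') → IsPullbackSub g m n → IsImage f' n
    bottom    : ∀ Y → Sub Y
    bottom-is : ∀ Y → IsBottom (bottom Y)
    bottom-stable : ∀ {Y Y'} (g : Y' ⇒ Y) (m : Sub Y) → IsBottom m →
                    (n : Sub Y') → IsPullbackSub g m n → IsBottom n
    join    : ∀ {Y} → Sub Y → Sub Y → Sub Y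
    join-is : ∀ {Y} (a b : Sub Y) → IsJoin a b (join a b)
    join-stable : ∀ {Y Y'} (g : Y' ⇒ Y) (a b j : Sub Y) → IsJoin a b j →
                  (a' b' j' : Sub Y') → IsPullbackSub g a a' → IsPullbackSub g b b' →
                  IsPullbackSub g j j' → IsJoin a' b' j'

  open Terminal terminal public

  infixr 7 _×_
  _×_ : Obj → Obj → Obj
  A × B = Product.A×B (products A B)

  π₁ : ∀ {A B} → A × B ⇒ A
  π₁ {A} {B} = Product.π₁ (products A B)

  π₂ : ∀ {A B} → A × B ⇒ B
  π₂ {A} {B} = Product.π₂ (products A B)

  ⟨_,_⟩ : ∀ {Z A B} → Z ⇒ A → Z ⇒ B → Z ⇒ A × B
  ⟨_,_⟩ {Z} {A} {B} = Product.⟨_,_⟩ (products A B)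

  IsPNO : (N : Obj) → 𝟙 ⇒ N → N ⇒ N → Set (o ⊔ ℓ ⊔ e)
  IsPNO N z s = ∀ {A X} (f : A ⇒ X) (g : X ⇒ X) →
    Σ (A × N ⇒ X) λ r →
      (r ∘ ⟨ id , z ∘ ! ⟩ ≈ f) ×ᵖ (r ∘ ⟨ π₁ , s ∘ π₂ ⟩ ≈ g ∘ r) ×ᵖ
      (∀ (r' : A × N ⇒ X) → r' ∘ ⟨ id , z ∘ ! ⟩ ≈ f → r' ∘ ⟨ π₁ , s ∘ π₂ ⟩ ≈ g ∘ r' → r' ≈ r)

{-# OPTIONS --safe #-}
-- Glue the identity on φ and the successor (x , n) ↦ (x , n + 1) on its complement into a
-- map step : X × N → X × N, and let search (x , n) = stepⁿ (x , 0) by parametrised recursion.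
-- By induction on n, search (x , n) is either still (x , n) or a point of φ that step no
-- longer moves.  Hence search maps φ into the subobject L of points of φ fixed by search,
-- the least witnesses.  Two least witnesses (x , n) and (x , m) over the same x coincide,
-- since both equal search (x , n + m) = search (x , m + n); so L is a subobject of X.
-- It contains the image of φ, which is all of X, and the inverse of L → X gives f.
module Submission where

open import Defs
open import Level using (Level; _⊔_)
open import Data.Product using (Σ; _,_; proj₁; proj₂) renaming (_×_ to _×ᵖ_)
open import Relation.Binary using (Setoid; IsEquivalence)
import Relation.Binary.Reasoning.Setoid as SetoidReasoning

module Morphisms {o ℓ e} (𝒞 : CoherentCategory o ℓ e) where
  open CoherentCategory 𝒞

  refl≈ : ∀ {A B} {f : A ⇒ B} → f ≈ f
  refl≈ = IsEquivalence.refl equiv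

  sym≈ : ∀ {A B} {f g : A ⇒ B} → f ≈ g → g ≈ f
  sym≈ = IsEquivalence.sym equiv

  trans≈ : ∀ {A B} {f g h : A ⇒ B} → f ≈ g → g ≈ h → f ≈ h
  trans≈ = IsEquivalence.trans equiv

  hom-setoid : Obj → Obj → Setoid ℓ e
  hom-setoid A B = record { Carrier = A ⇒ B ; _≈_ = _≈_ ; isEquivalence = equiv }

  module HomReasoning {A B : Obj} = SetoidReasoning (hom-setoid A B)
  open HomReasoning public hiding (start)

  ∘-resp-≈ˡ : ∀ {A B C} {f h : B ⇒ C} {g : A ⇒ B} → f ≈ h → f ∘ g ≈ h ∘ g
  ∘-resp-≈ˡ p = ∘-resp-≈ p refl≈

  ∘-resp-≈ʳ : ∀ {A B C} {f : B ⇒ C} {g i : A ⇒ B} → g ≈ i → f ∘ g ≈ f ∘ i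
  ∘-resp-≈ʳ p = ∘-resp-≈ refl≈ p

  sym-assoc : ∀ {A B C D} {f : A ⇒ B} {g : B ⇒ C} {h : C ⇒ D} → h ∘ (g ∘ f) ≈ (h ∘ g) ∘ f
  sym-assoc = sym≈ assoc

  project₁ : ∀ {Z A B} {f : Z ⇒ A} {g : Z ⇒ B} → π₁ ∘ ⟨ f , g ⟩ ≈ f
  project₁ {A = A} {B} = Product.project₁ (products A B)

  project₂ : ∀ {Z A B} {f : Z ⇒ A} {g : Z ⇒ B} → π₂ ∘ ⟨ f , g ⟩ ≈ g
  project₂ {A = A} {B} = Product.project₂ (products A B)

  ⟨⟩-unique : ∀ {Z A B} {f : Z ⇒ A} {g : Z ⇒ B} (h : Z ⇒ A × B) →
              π₁ ∘ h ≈ f → π₂ ∘ h ≈ g → h ≈ ⟨ f , g ⟩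
  ⟨⟩-unique {A = A} {B} = Product.unique (products A B)

  ⟨⟩-cong₂ : ∀ {Z A B} {f f′ : Z ⇒ A} {g g′ : Z ⇒ B} → f ≈ f′ → g ≈ g′ → ⟨ f , g ⟩ ≈ ⟨ f′ , g′ ⟩
  ⟨⟩-cong₂ p q = ⟨⟩-unique _ (trans≈ project₁ p) (trans≈ project₂ q)

  ∘-distribʳ-⟨⟩ : ∀ {W Z A B} {f : Z ⇒ A} {g : Z ⇒ B} {h : W ⇒ Z} →
                  ⟨ f , g ⟩ ∘ h ≈ ⟨ f ∘ h , g ∘ h ⟩
  ∘-distribʳ-⟨⟩ = ⟨⟩-unique _ (trans≈ sym-assoc (∘-resp-≈ˡ project₁))
                             (trans≈ sym-assoc (∘-resp-≈ˡ project₂))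

  g-η : ∀ {A B C} {w : C ⇒ A × B} → ⟨ π₁ ∘ w , π₂ ∘ w ⟩ ≈ w
  g-η {w = w} = sym≈ (⟨⟩-unique w refl≈ refl≈)

  pullʳ-project₁ : ∀ {A B C D} {x : A ⇒ D} {f : C ⇒ A} {g : C ⇒ B} → (x ∘ π₁) ∘ ⟨ f , g ⟩ ≈ x ∘ f
  pullʳ-project₁ = trans≈ assoc (∘-resp-≈ʳ project₁)

  mono⇒⟨⟩-mono : ∀ {Z A B} {f : A ⇒ Z} {g : A ⇒ B} → Mono f → Mono ⟨ f , g ⟩
  mono⇒⟨⟩-mono {f = f} {g} f-mono u v eq = f-mono u v (begin
    f ∘ u                 ≈⟨ ∘-resp-≈ˡ (sym≈ project₁) ⟩
    (π₁ ∘ ⟨ f , g ⟩) ∘ u  ≈⟨ assoc ⟩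
    π₁ ∘ (⟨ f , g ⟩ ∘ u)  ≈⟨ ∘-resp-≈ʳ eq ⟩
    π₁ ∘ (⟨ f , g ⟩ ∘ v)  ≈⟨ sym-assoc ⟩
    (π₁ ∘ ⟨ f , g ⟩) ∘ v  ≈⟨ ∘-resp-≈ˡ project₁ ⟩
    f ∘ v                 ∎)

module Elements {o ℓ e} (𝒞 : CoherentCategory o ℓ e) where
  open CoherentCategory 𝒞
  open Morphisms 𝒞

  infix 4 _∈_
  record _∈_ {W Y} (p : W ⇒ Y) (S : Sub Y) : Set (ℓ ⊔ e) where
    constructor factor
    field
      witness  : W ⇒ dom S
      commutes : arr S ∘ witness ≈ p

  ∈-resp-≈ : ∀ {W Y} {p p′ : W ⇒ Y} {S : Sub Y} → p ≈ p′ → p ∈ S → p′ ∈ S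
  ∈-resp-≈ p≈p′ (factor q eq) = factor q (trans≈ eq p≈p′)

  ∈-∘ : ∀ {V W Y} {p : W ⇒ Y} {S : Sub Y} → p ∈ S → (v : V ⇒ W) → p ∘ v ∈ S
  ∈-∘ (factor q eq) v = factor (q ∘ v) (trans≈ sym-assoc (∘-resp-≈ˡ eq))

  ∈-≤ : ∀ {W Y} {p : W ⇒ Y} {S T : Sub Y} → p ∈ S → S ≤ T → p ∈ T
  ∈-≤ (factor q eq) (h , eh) = factor (h ∘ q) (trans≈ sym-assoc (trans≈ (∘-resp-≈ˡ eh) eq))

  arr∈ : ∀ {Y} {S : Sub Y} → arr S ∈ S
  arr∈ = factor id identityʳ

  ∈⇒≤ : ∀ {Y} (S : Sub Y) {T : Sub Y} → arr S ∈ T → S ≤ T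
  ∈⇒≤ _ (factor q eq) = q , eq

  IsTop⇒id∈ : ∀ {Y} {S : Sub Y} → IsTop S → id ∈ S
  IsTop⇒id∈ (h , eh) = factor h eh

  id∈⇒∈ : ∀ {W Y} {S : Sub Y} → id ∈ S → (p : W ⇒ Y) → p ∈ S
  id∈⇒∈ h p = ∈-resp-≈ identityˡ (∈-∘ h p)

  module PullbackSub {Y Y′} (g : Y′ ⇒ Y) (S : Sub Y) where
    open Pullback (pullbacks (arr S) g) public

    commute : arr S ∘ p₁ ≈ g ∘ p₂
    commute = proj₁ isPullback

    universal : ∀ {Q} (q₁ : Q ⇒ dom S) (q₂ : Q ⇒ Y′) → arr S ∘ q₁ ≈ g ∘ q₂ →
      Σ (Q ⇒ P) λ u → (p₁ ∘ u ≈ q₁) ×ᵖ (p₂ ∘ u ≈ q₂) ×ᵖ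
         (∀ (u′ : Q ⇒ P) → p₁ ∘ u′ ≈ q₁ → p₂ ∘ u′ ≈ q₂ → u′ ≈ u)
    universal = proj₂ isPullback

    commute∘ : ∀ {Q} (u : Q ⇒ P) → arr S ∘ (p₁ ∘ u) ≈ g ∘ (p₂ ∘ u)
    commute∘ u = trans≈ sym-assoc (trans≈ (∘-resp-≈ˡ commute) assoc)

    jointly-mono : ∀ {Q} {u u′ : Q ⇒ P} → p₁ ∘ u ≈ p₁ ∘ u′ → p₂ ∘ u ≈ p₂ ∘ u′ → u ≈ u′
    jointly-mono {u = u} {u′} e₁ e₂ with universal (p₁ ∘ u) (p₂ ∘ u) (commute∘ u)
    ... | _ , _ , _ , unique = trans≈ (unique u refl≈ refl≈) (sym≈ (unique u′ (sym≈ e₁) (sym≈ e₂)))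

    p₂-mono : Mono p₂
    p₂-mono a b eq =
      jointly-mono (mono S _ _ (trans≈ (commute∘ a) (trans≈ (∘-resp-≈ʳ eq) (sym≈ (commute∘ b))))) eq

  pullbackSub : ∀ {Y Y′} (g : Y′ ⇒ Y) (S : Sub Y) → Sub Y′
  pullbackSub g S = record { dom = P ; arr = p₂ ; mono = p₂-mono }
    where open PullbackSub g S

  pullbackSub⁺ : ∀ {V Y Y′} (g : Y′ ⇒ Y) (S : Sub Y) {v : V ⇒ Y′} → g ∘ v ∈ S → v ∈ pullbackSub g S
  pullbackSub⁺ g S {v} (factor q eq) with PullbackSub.universal g S q v eq
  ... | u , _ , p₂u≈v , _ = factor u p₂u≈v

  pullbackSub⁻ : ∀ {V Y Y′} (g : Y′ ⇒ Y) (S : Sub Y) {v : V ⇒ Y′} → v ∈ pullbackSub g S → g ∘ v ∈ S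
  pullbackSub⁻ g S {v} (factor q eq) = factor (p₁ ∘ q) (begin
    arr S ∘ (p₁ ∘ q)  ≈⟨ sym-assoc ⟩
    (arr S ∘ p₁) ∘ q  ≈⟨ ∘-resp-≈ˡ commute ⟩
    (g ∘ p₂) ∘ q      ≈⟨ assoc ⟩
    g ∘ (p₂ ∘ q)      ≈⟨ ∘-resp-≈ʳ eq ⟩
    g ∘ v             ∎)
    where open PullbackSub g S

  pullbackSub-isPullbackSub : ∀ {Y Y′} (g : Y′ ⇒ Y) (S : Sub Y) → IsPullbackSub g S (pullbackSub g S)
  pullbackSub-isPullbackSub g S = PullbackSub.p₁ g S , PullbackSub.isPullback g S

  top-isPullbackSub : ∀ {W Y} (p : W ⇒ Y) (S : Sub Y) → p ∈ S → IsPullbackSub p S (topSub W)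
  top-isPullbackSub {W} p S (factor q eq) = q , trans≈ eq (sym≈ identityʳ) , universal
    where
    universal : ∀ {Q} (q₁ : Q ⇒ dom S) (q₂ : Q ⇒ W) → arr S ∘ q₁ ≈ p ∘ q₂ →
      Σ (Q ⇒ W) λ u → (q ∘ u ≈ q₁) ×ᵖ (id ∘ u ≈ q₂) ×ᵖ
        (∀ (u′ : Q ⇒ W) → q ∘ u′ ≈ q₁ → id ∘ u′ ≈ q₂ → u′ ≈ u)
    universal q₁ q₂ eq′ = q₂ , mono S _ _ (trans≈ sym-assoc (trans≈ (∘-resp-≈ˡ eq) (sym≈ eq′))) ,
                          identityˡ , λ u′ _ idu′≈q₂ → trans≈ (sym≈ identityˡ) idu′≈q₂

  -- Pulling the join back along p (stability) makes the two pullbacks cover W.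
  join-elim : ∀ {W Y} (p : W ⇒ Y) (S T J : Sub Y) → IsJoin S T J → p ∈ J → (U : Sub W) →
    (∀ {V} (v : V ⇒ W) → p ∘ v ∈ S → v ∈ U) →
    (∀ {V} (v : V ⇒ W) → p ∘ v ∈ T → v ∈ U) → id ∈ U
  join-elim {W} p S T J isJoin p∈J U on-S on-T = IsTop⇒id∈ (proj₂ (proj₂ pulled-back) U
      (∈⇒≤ (pullbackSub p S) (on-S (arr (pullbackSub p S)) (pullbackSub⁻ p S arr∈)))
      (∈⇒≤ (pullbackSub p T) (on-T (arr (pullbackSub p T)) (pullbackSub⁻ p T arr∈))))
    where
    pulled-back : IsJoin (pullbackSub p S) (pullbackSub p T) (topSub W)
    pulled-back = join-stable p S T J isJoin (pullbackSub p S) (pullbackSub p T) (topSub W)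
      (pullbackSub-isPullbackSub p S) (pullbackSub-isPullbackSub p T) (top-isPullbackSub p J p∈J)

  join-elim-∈ : ∀ {W Y Z} (p : W ⇒ Y) (S T J : Sub Y) → IsJoin S T J → p ∈ J →
    (q : W ⇒ Z) (U : Sub Z) →
    (∀ {V} (v : V ⇒ W) → p ∘ v ∈ S → q ∘ v ∈ U) →
    (∀ {V} (v : V ⇒ W) → p ∘ v ∈ T → q ∘ v ∈ U) → q ∈ U
  join-elim-∈ p S T J isJoin p∈J q U on-S on-T = ∈-resp-≈ identityʳ (pullbackSub⁻ q U
    (join-elim p S T J isJoin p∈J (pullbackSub q U)
      (λ v h → pullbackSub⁺ q U (on-S v h)) (λ v h → pullbackSub⁺ q U (on-T v h))))

  diagonal : ∀ Z → Sub (Z × Z)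
  diagonal Z = record { dom = Z ; arr = ⟨ id , id ⟩
                      ; mono = mono⇒⟨⟩-mono (mono (topSub Z)) }

  equaliser : ∀ {W Z} (f g : W ⇒ Z) → Sub W
  equaliser {Z = Z} f g = pullbackSub ⟨ f , g ⟩ (diagonal Z)

  equaliser⁺ : ∀ {V W Z} (f g : W ⇒ Z) {v : V ⇒ W} → f ∘ v ≈ g ∘ v → v ∈ equaliser f g
  equaliser⁺ {Z = Z} f g {v} fv≈gv = pullbackSub⁺ ⟨ f , g ⟩ (diagonal Z) (factor (f ∘ v) (begin
    ⟨ id , id ⟩ ∘ (f ∘ v)                ≈⟨ ∘-distribʳ-⟨⟩ ⟩
    ⟨ id ∘ (f ∘ v) , id ∘ (f ∘ v) ⟩      ≈⟨ ⟨⟩-cong₂ identityˡ (trans≈ identityˡ fv≈gv) ⟩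
    ⟨ f ∘ v , g ∘ v ⟩                    ≈⟨ sym≈ ∘-distribʳ-⟨⟩ ⟩
    ⟨ f , g ⟩ ∘ v                        ∎))

  equaliser⁻ : ∀ {V W Z} (f g : W ⇒ Z) {v : V ⇒ W} → v ∈ equaliser f g → f ∘ v ≈ g ∘ v
  equaliser⁻ {W = W} {Z} f g {v} h with pullbackSub⁻ ⟨ f , g ⟩ (diagonal Z) h
  ... | factor q eq = trans≈ (component π₁ project₁ project₁) (sym≈ (component π₂ project₂ project₂))
    where
    component : ∀ {k : W ⇒ Z} (π : Z × Z ⇒ Z) → π ∘ ⟨ f , g ⟩ ≈ k → π ∘ ⟨ id , id ⟩ ≈ id → k ∘ v ≈ q
    component {k} π π⟨f,g⟩≈k π-diagonal = begin
      k ∘ v                    ≈⟨ ∘-resp-≈ˡ (sym≈ π⟨f,g⟩≈k) ⟩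
      (π ∘ ⟨ f , g ⟩) ∘ v      ≈⟨ assoc ⟩
      π ∘ (⟨ f , g ⟩ ∘ v)      ≈⟨ ∘-resp-≈ʳ (sym≈ eq) ⟩
      π ∘ (⟨ id , id ⟩ ∘ q)    ≈⟨ sym-assoc ⟩
      (π ∘ ⟨ id , id ⟩) ∘ q    ≈⟨ ∘-resp-≈ˡ π-diagonal ⟩
      id ∘ q                   ≈⟨ identityˡ ⟩
      q                        ∎

  id∈equaliser⇒≈ : ∀ {W Z} {f g : W ⇒ Z} → id ∈ equaliser f g → f ≈ g
  id∈equaliser⇒≈ {f = f} {g} h = trans≈ (sym≈ identityʳ) (trans≈ (equaliser⁻ f g h) identityʳ)

  join-elim-≈ : ∀ {W Y Z} (p : W ⇒ Y) (S T J : Sub Y) → IsJoin S T J → p ∈ J →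
    (f g : W ⇒ Z) →
    (∀ {V} (v : V ⇒ W) → p ∘ v ∈ S → f ∘ v ≈ g ∘ v) →
    (∀ {V} (v : V ⇒ W) → p ∘ v ∈ T → f ∘ v ≈ g ∘ v) → f ≈ g
  join-elim-≈ p S T J isJoin p∈J f g on-S on-T = id∈equaliser⇒≈ (join-elim p S T J isJoin p∈J (equaliser f g)
    (λ v h → equaliser⁺ f g (on-S v h)) (λ v h → equaliser⁺ f g (on-T v h)))

  composite : ∀ {Y} (T : Sub Y) → Sub (dom T) → Sub Y
  composite T S = record { dom = dom S ; arr = arr T ∘ arr S ; mono = λ a b eq →
    mono S a b (mono T _ _ (trans≈ sym-assoc (trans≈ eq assoc))) }

  composite⁺ : ∀ {V Y} (T : Sub Y) (S : Sub (dom T)) {v : V ⇒ Y} {q : V ⇒ dom T} →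
    arr T ∘ q ≈ v → q ∈ S → v ∈ composite T S
  composite⁺ T S Tq≈v (factor q′ eq) = factor q′ (trans≈ assoc (trans≈ (∘-resp-≈ʳ eq) Tq≈v))

  -- y factors through φ ∧ ψ ≤ μ, and the bottom μ pulls back along y to the bottom of W.
  ∈-disjoint⇒≈ : ∀ {W Y Z} {φ ψ μ : Sub Y} → IsMeet φ ψ μ → IsBottom μ → {y : W ⇒ Y} →
    y ∈ φ → y ∈ ψ → (f g : W ⇒ Z) → f ≈ g
  ∈-disjoint⇒≈ {W} {Y} {φ = φ} {ψ} {μ} isMeet bottom {y} (factor c ec) y∈ψ f g =
    id∈equaliser⇒≈ (IsTop⇒id∈ (W-bottom (equaliser f g)))
    where
    φ∧ψ : Sub Y
    φ∧ψ = composite φ (pullbackSub (arr φ) ψ)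
    φ∧ψ≤μ : φ∧ψ ≤ μ
    φ∧ψ≤μ = proj₂ (proj₂ isMeet) φ∧ψ (_ , refl≈) (∈⇒≤ φ∧ψ (pullbackSub⁻ (arr φ) ψ arr∈))
    y∈μ : y ∈ μ
    y∈μ = ∈-≤ (composite⁺ φ (pullbackSub (arr φ) ψ) ec (pullbackSub⁺ (arr φ) ψ (∈-resp-≈ (sym≈ ec) y∈ψ))) φ∧ψ≤μ
    W-bottom : IsBottom (topSub W)
    W-bottom = bottom-stable y μ bottom (topSub W) (top-isPullbackSub y μ y∈μ)

module Copairing {o ℓ e} (𝒞 : CoherentCategory o ℓ e) where
  open CoherentCategory 𝒞
  open Morphisms 𝒞
  open Elements 𝒞

  graph : ∀ {Y Z} (S : Sub Y) → (dom S ⇒ Z) → Sub (Y × Z)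
  graph S c = record { dom = dom S ; arr = ⟨ arr S , c ⟩ ; mono = mono⇒⟨⟩-mono (mono S) }

  -- The union Γ of the graphs of a and b projects monically to Y: locally two points of Γ
  -- lie in a common graph, mixed cases being excluded by disjointness.  The projection
  -- covers J = Y, and the copairing is π₂ after its inverse.
  module Copair {Y Z} {φ ψ μ J : Sub Y} (isMeet : IsMeet φ ψ μ) (bottom : IsBottom μ)
      (isJoin : IsJoin φ ψ J) (top : IsTop J) (a : dom φ ⇒ Z) (b : dom ψ ⇒ Z) where
    Γa Γb Γ : Sub (Y × Z)
    Γa = graph φ a
    Γb = graph ψ b
    Γ  = join Γa Γb

    p : dom Γ ⇒ Y
    p = π₁ ∘ arr Γ

    p-on-graph : (S : Sub Y) (c : dom S ⇒ Z) {V : Obj} {q : V ⇒ dom S} {x : V ⇒ dom Γ} →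
      ⟨ arr S , c ⟩ ∘ q ≈ arr Γ ∘ x → p ∘ x ≈ arr S ∘ q
    p-on-graph S c {q = q} {x} eq = begin
      (π₁ ∘ arr Γ) ∘ x         ≈⟨ assoc ⟩
      π₁ ∘ (arr Γ ∘ x)         ≈⟨ ∘-resp-≈ʳ (sym≈ eq) ⟩
      π₁ ∘ (⟨ arr S , c ⟩ ∘ q) ≈⟨ sym-assoc ⟩
      (π₁ ∘ ⟨ arr S , c ⟩) ∘ q ≈⟨ ∘-resp-≈ˡ project₁ ⟩
      arr S ∘ q                ∎

    p-mono-within-graph : (S : Sub Y) (c : dom S ⇒ Z) {V : Obj} {x y : V ⇒ dom Γ} →
      arr Γ ∘ x ∈ graph S c → arr Γ ∘ y ∈ graph S c → p ∘ x ≈ p ∘ y → x ≈ y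
    p-mono-within-graph S c {x = x} {y} (factor q₁ e₁) (factor q₂ e₂) px≈py = mono Γ x y (begin
      arr Γ ∘ x              ≈⟨ sym≈ e₁ ⟩
      ⟨ arr S , c ⟩ ∘ q₁     ≈⟨ ∘-resp-≈ʳ q₁≈q₂ ⟩
      ⟨ arr S , c ⟩ ∘ q₂     ≈⟨ e₂ ⟩
      arr Γ ∘ y              ∎)
      where
      q₁≈q₂ : q₁ ≈ q₂
      q₁≈q₂ = mono S q₁ q₂ (trans≈ (sym≈ (p-on-graph S c e₁)) (trans≈ px≈py (p-on-graph S c e₂)))

    p-mono-across-graphs : {V : Obj} {x y : V ⇒ dom Γ} →
      arr Γ ∘ x ∈ Γa → arr Γ ∘ y ∈ Γb → p ∘ x ≈ p ∘ y → x ≈ y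
    p-mono-across-graphs {x = x} {y} (factor q₁ e₁) (factor q₂ e₂) px≈py =
      ∈-disjoint⇒≈ {φ = φ} {ψ} {μ} isMeet bottom (factor q₁ (sym≈ (p-on-graph φ a e₁)))
        (factor q₂ (trans≈ (sym≈ (p-on-graph ψ b e₂)) (sym≈ px≈py))) x y

    arr∘-∈ : ∀ {V W} {x : W ⇒ dom Γ} {Δ : Sub (Y × Z)} → arr Γ ∘ x ∈ Δ → (w : V ⇒ W) →
      arr Γ ∘ (x ∘ w) ∈ Δ
    arr∘-∈ h w = ∈-resp-≈ assoc (∈-∘ h w)

    p∘-≈ : ∀ {V W} {x y : W ⇒ dom Γ} (w : V ⇒ W) → p ∘ x ≈ p ∘ y → p ∘ (x ∘ w) ≈ p ∘ (y ∘ w)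
    p∘-≈ w eq = trans≈ sym-assoc (trans≈ (∘-resp-≈ˡ eq) assoc)

    p-mono-from-Γa : ∀ {V} (x y : V ⇒ dom Γ) → arr Γ ∘ x ∈ Γa → p ∘ x ≈ p ∘ y → x ≈ y
    p-mono-from-Γa x y x∈Γa px≈py = join-elim-≈ (arr Γ ∘ y) Γa Γb Γ (join-is Γa Γb) (factor y refl≈) x y
      (λ w h → p-mono-within-graph φ a (arr∘-∈ x∈Γa w) (∈-resp-≈ assoc h) (p∘-≈ w px≈py))
      (λ w h → p-mono-across-graphs (arr∘-∈ x∈Γa w) (∈-resp-≈ assoc h) (p∘-≈ w px≈py))

    p-mono-from-Γb : ∀ {V} (x y : V ⇒ dom Γ) → arr Γ ∘ x ∈ Γb → p ∘ x ≈ p ∘ y → x ≈ y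
    p-mono-from-Γb x y x∈Γb px≈py = join-elim-≈ (arr Γ ∘ y) Γa Γb Γ (join-is Γa Γb) (factor y refl≈) x y
      (λ w h → sym≈ (p-mono-across-graphs (∈-resp-≈ assoc h) (arr∘-∈ x∈Γb w) (sym≈ (p∘-≈ w px≈py))))
      (λ w h → p-mono-within-graph ψ b (arr∘-∈ x∈Γb w) (∈-resp-≈ assoc h) (p∘-≈ w px≈py))

    p-mono : Mono p
    p-mono x y px≈py = join-elim-≈ (arr Γ ∘ x) Γa Γb Γ (join-is Γa Γb) (factor x refl≈) x y
      (λ w h → p-mono-from-Γa (x ∘ w) (y ∘ w) (∈-resp-≈ assoc h) (p∘-≈ w px≈py))
      (λ w h → p-mono-from-Γb (x ∘ w) (y ∘ w) (∈-resp-≈ assoc h) (p∘-≈ w px≈py))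

    Γ-over-Y : Sub Y
    Γ-over-Y = record { dom = dom Γ ; arr = p ; mono = p-mono }

    p-over-graph : (S : Sub Y) (c : dom S ⇒ Z) (h : dom S ⇒ dom Γ) → arr Γ ∘ h ≈ ⟨ arr S , c ⟩ →
      p ∘ h ≈ arr S
    p-over-graph S c h eh = trans≈ (p-on-graph S c (trans≈ identityʳ (sym≈ eh))) identityʳ

    Γa≤Γ : Γa ≤ Γ
    Γa≤Γ = proj₁ (join-is Γa Γb)
    Γb≤Γ : Γb ≤ Γ
    Γb≤Γ = proj₁ (proj₂ (join-is Γa Γb))

    J≤Γ-over-Y : J ≤ Γ-over-Y
    J≤Γ-over-Y = proj₂ (proj₂ isJoin) Γ-over-Y
      (proj₁ Γa≤Γ , p-over-graph φ a (proj₁ Γa≤Γ) (proj₂ Γa≤Γ))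
      (proj₁ Γb≤Γ , p-over-graph ψ b (proj₁ Γb≤Γ) (proj₂ Γb≤Γ))

    id∈Γ-over-Y : id ∈ Γ-over-Y
    id∈Γ-over-Y = ∈-≤ (IsTop⇒id∈ {S = J} top) J≤Γ-over-Y

    section : Y ⇒ dom Γ
    section = _∈_.witness id∈Γ-over-Y

    p∘section : p ∘ section ≈ id
    p∘section = _∈_.commutes id∈Γ-over-Y

    c : Y ⇒ Z
    c = π₂ ∘ (arr Γ ∘ section)

    c-on-graph : (S : Sub Y) (c₀ : dom S ⇒ Z) (h : dom S ⇒ dom Γ) → arr Γ ∘ h ≈ ⟨ arr S , c₀ ⟩ →
      c ∘ arr S ≈ c₀
    c-on-graph S c₀ h eh = begin
      (π₂ ∘ (arr Γ ∘ section)) ∘ arr S ≈⟨ assoc ⟩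
      π₂ ∘ ((arr Γ ∘ section) ∘ arr S) ≈⟨ ∘-resp-≈ʳ assoc ⟩
      π₂ ∘ (arr Γ ∘ (section ∘ arr S)) ≈⟨ ∘-resp-≈ʳ (∘-resp-≈ʳ section∘S≈h) ⟩
      π₂ ∘ (arr Γ ∘ h)                 ≈⟨ ∘-resp-≈ʳ eh ⟩
      π₂ ∘ ⟨ arr S , c₀ ⟩              ≈⟨ project₂ ⟩
      c₀                               ∎
      where
      section∘S≈h : section ∘ arr S ≈ h
      section∘S≈h = p-mono (section ∘ arr S) h (begin
        p ∘ (section ∘ arr S) ≈⟨ sym-assoc ⟩
        (p ∘ section) ∘ arr S ≈⟨ ∘-resp-≈ˡ p∘section ⟩
        id ∘ arr S            ≈⟨ identityˡ ⟩
        arr S                 ≈⟨ sym≈ (p-over-graph S c₀ h eh) ⟩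
        p ∘ h                 ∎)

  copair : ∀ {Y Z} {φ ψ μ J : Sub Y} → IsMeet φ ψ μ → IsBottom μ → IsJoin φ ψ J → IsTop J →
    (a : dom φ ⇒ Z) (b : dom ψ ⇒ Z) → Σ (Y ⇒ Z) λ c → (c ∘ arr φ ≈ a) ×ᵖ (c ∘ arr ψ ≈ b)
  copair {φ = φ} {ψ} {μ} {J} isMeet bottom isJoin top a b =
    c , c-on-graph φ a (proj₁ Γa≤Γ) (proj₂ Γa≤Γ) , c-on-graph ψ b (proj₁ Γb≤Γ) (proj₂ Γb≤Γ)
    where open Copair {φ = φ} {ψ} {μ} {J} isMeet bottom isJoin top a b

module ParametrisedRecursion {o ℓ e} (𝒞 : CoherentCategory o ℓ e) where
  open CoherentCategory 𝒞
  open Morphisms 𝒞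
  open Elements 𝒞

  module PNO (N : Obj) (z : 𝟙 ⇒ N) (s : N ⇒ N) (pno : IsPNO N z s) where
    start : ∀ {A} → A ⇒ A × N
    start = ⟨ id , z ∘ ! ⟩

    next : ∀ {A} → A × N ⇒ A × N
    next = ⟨ π₁ , s ∘ π₂ ⟩

    rec-unique : ∀ {A Z} (f : A ⇒ Z) (g : Z ⇒ Z) (r r′ : A × N ⇒ Z) →
      r ∘ start ≈ f → r ∘ next ≈ g ∘ r → r′ ∘ start ≈ f → r′ ∘ next ≈ g ∘ r′ → r ≈ r′
    rec-unique f g r r′ r-start r-next r′-start r′-next with pno f g
    ... | _ , _ , _ , unique = trans≈ (unique r r-start r-next) (sym≈ (unique r′ r′-start r′-next))

    z∘!-∘ : ∀ {A B} {f : A ⇒ B} → (z ∘ !) ∘ f ≈ z ∘ !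
    z∘!-∘ {f = f} = trans≈ assoc (∘-resp-≈ʳ (!-uniq (! ∘ f)))

    start∘ : ∀ {A B} {a : B ⇒ A} → start ∘ a ≈ ⟨ a , z ∘ ! ⟩
    start∘ = trans≈ ∘-distribʳ-⟨⟩ (⟨⟩-cong₂ identityˡ z∘!-∘)

    next∘⟨⟩ : ∀ {A B} {a : B ⇒ A} {b : B ⇒ N} → next ∘ ⟨ a , b ⟩ ≈ ⟨ a , s ∘ b ⟩
    next∘⟨⟩ = trans≈ ∘-distribʳ-⟨⟩ (⟨⟩-cong₂ project₁ (trans≈ assoc (∘-resp-≈ʳ project₂)))

    induction : ∀ {A} (S : Sub (A × N)) → start ∈ S → next ∘ arr S ∈ S → id ∈ S
    induction S (factor b eb) (factor t et) with pno b t
    ... | r , r-start , r-next , _ = factor r (rec-unique start next (arr S ∘ r) id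
      (trans≈ assoc (trans≈ (∘-resp-≈ʳ r-start) eb))
      (trans≈ assoc (trans≈ (∘-resp-≈ʳ r-next) (trans≈ sym-assoc (trans≈ (∘-resp-≈ˡ et) assoc))))
      identityˡ
      (trans≈ identityˡ (sym≈ identityʳ)))

    add : N × N ⇒ N
    add = proj₁ (pno id s)

    add-start : add ∘ start ≈ id
    add-start = proj₁ (proj₂ (pno id s))

    add-next : add ∘ next ≈ s ∘ add
    add-next = proj₁ (proj₂ (proj₂ (pno id s)))

    infixl 6 _⊕_
    _⊕_ : ∀ {W} → W ⇒ N → W ⇒ N → W ⇒ N
    a ⊕ b = add ∘ ⟨ a , b ⟩

    ⊕-identityʳ : ∀ {W} {a : W ⇒ N} → a ⊕ z ∘ ! ≈ a
    ⊕-identityʳ {a = a} = begin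
      add ∘ ⟨ a , z ∘ ! ⟩  ≈⟨ ∘-resp-≈ʳ (sym≈ start∘) ⟩
      add ∘ (start ∘ a)    ≈⟨ sym-assoc ⟩
      (add ∘ start) ∘ a    ≈⟨ ∘-resp-≈ˡ add-start ⟩
      id ∘ a               ≈⟨ identityˡ ⟩
      a                    ∎

    ⊕-sucʳ : ∀ {W} {a b : W ⇒ N} → a ⊕ s ∘ b ≈ s ∘ (a ⊕ b)
    ⊕-sucʳ {a = a} {b} = begin
      add ∘ ⟨ a , s ∘ b ⟩       ≈⟨ ∘-resp-≈ʳ (sym≈ next∘⟨⟩) ⟩
      add ∘ (next ∘ ⟨ a , b ⟩)  ≈⟨ sym-assoc ⟩
      (add ∘ next) ∘ ⟨ a , b ⟩  ≈⟨ ∘-resp-≈ˡ add-next ⟩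
      (s ∘ add) ∘ ⟨ a , b ⟩     ≈⟨ assoc ⟩
      s ∘ (a ⊕ b)               ∎

    ⊕-∘ : ∀ {V W} {a b : W ⇒ N} {h : V ⇒ W} → (a ⊕ b) ∘ h ≈ a ∘ h ⊕ b ∘ h
    ⊕-∘ = trans≈ assoc (∘-resp-≈ʳ ∘-distribʳ-⟨⟩)

    ⊕-cong : ∀ {W} {a a′ b b′ : W ⇒ N} → a ≈ a′ → b ≈ b′ → a ⊕ b ≈ a′ ⊕ b′
    ⊕-cong p q = ∘-resp-≈ʳ (⟨⟩-cong₂ p q)

    ⊕-identityˡ : ∀ {W} {b : W ⇒ N} → z ∘ ! ⊕ b ≈ b
    ⊕-identityˡ {b = b} = begin
      z ∘ ! ⊕ b                                  ≈⟨ ⊕-cong (sym≈ z∘!-∘) (sym≈ project₂) ⟩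
      (z ∘ !) ∘ ⟨ b , b ⟩ ⊕ π₂ ∘ ⟨ b , b ⟩       ≈⟨ sym≈ ⊕-∘ ⟩
      (z ∘ ! ⊕ π₂) ∘ ⟨ b , b ⟩                   ≈⟨ ∘-resp-≈ˡ 0⊕n≈n ⟩
      π₂ ∘ ⟨ b , b ⟩                             ≈⟨ project₂ ⟩
      b                                          ∎
      where
      0⊕n≈n : z ∘ ! ⊕ π₂ ≈ π₂ {N} {N}
      0⊕n≈n = rec-unique (z ∘ !) s _ π₂
        (trans≈ ⊕-∘ (trans≈ (⊕-cong z∘!-∘ project₂) ⊕-identityʳ))
        (trans≈ ⊕-∘ (trans≈ (⊕-cong z∘!-∘ project₂) ⊕-sucʳ))
        project₂ project₂

    ⊕-sucˡ : ∀ {W} {a b : W ⇒ N} → s ∘ a ⊕ b ≈ s ∘ (a ⊕ b)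
    ⊕-sucˡ {a = a} {b} = begin
      s ∘ a ⊕ b                                  ≈⟨ ⊕-cong (sym≈ pullʳ-project₁) (sym≈ project₂) ⟩
      (s ∘ π₁) ∘ ⟨ a , b ⟩ ⊕ π₂ ∘ ⟨ a , b ⟩      ≈⟨ sym≈ ⊕-∘ ⟩
      (s ∘ π₁ ⊕ π₂) ∘ ⟨ a , b ⟩                  ≈⟨ ∘-resp-≈ˡ sm⊕n≈s[m⊕n] ⟩
      (s ∘ add) ∘ ⟨ a , b ⟩                      ≈⟨ assoc ⟩
      s ∘ (a ⊕ b)                                ∎
      where
      sm⊕n≈s[m⊕n] : s ∘ π₁ ⊕ π₂ ≈ s ∘ add
      sm⊕n≈s[m⊕n] = rec-unique s s _ (s ∘ add)
        (trans≈ ⊕-∘ (trans≈ (⊕-cong (trans≈ pullʳ-project₁ identityʳ) project₂) ⊕-identityʳ))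
        (trans≈ ⊕-∘ (trans≈ (⊕-cong pullʳ-project₁ project₂) ⊕-sucʳ))
        (trans≈ assoc (trans≈ (∘-resp-≈ʳ add-start) identityʳ))
        (trans≈ assoc (∘-resp-≈ʳ add-next))

    ⊕-comm : ∀ {W} (a b : W ⇒ N) → a ⊕ b ≈ b ⊕ a
    ⊕-comm a b = begin
      add ∘ ⟨ a , b ⟩                          ≈⟨ ∘-resp-≈ˡ add≈flipped ⟩
      (π₂ ⊕ π₁) ∘ ⟨ a , b ⟩                    ≈⟨ ⊕-∘ ⟩
      π₂ ∘ ⟨ a , b ⟩ ⊕ π₁ ∘ ⟨ a , b ⟩          ≈⟨ ⊕-cong project₂ project₁ ⟩
      b ⊕ a                                    ∎
      where
      add≈flipped : add ≈ π₂ ⊕ π₁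
      add≈flipped = rec-unique id s add (π₂ ⊕ π₁) add-start add-next
        (trans≈ ⊕-∘ (trans≈ (⊕-cong project₂ project₁) ⊕-identityˡ))
        (trans≈ ⊕-∘ (trans≈ (⊕-cong project₂ project₁) ⊕-sucˡ))

module FunctionalRelations {o ℓ e} (𝒞 : CoherentCategory o ℓ e) where
  open CoherentCategory 𝒞
  open Morphisms 𝒞
  open Elements 𝒞

  domainSub : ∀ {X B} (L : Sub (X × B)) → Mono (π₁ ∘ arr L) → Sub X
  domainSub L functional = record { dom = dom L ; arr = π₁ ∘ arr L ; mono = functional }

  -- L is the graph of a partial map; its domain contains the image of φ, which is all of X.
  section-from-functional-part : ∀ {X B} (φ L : Sub (X × B)) → L ≤ φ →
    (functional : Mono (π₁ ∘ arr L)) → π₁ ∘ arr φ ∈ domainSub L functional →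
    topSub X ≤ image (π₁ ∘ arr φ) →
    Σ (X ⇒ B) λ f → Σ (X ⇒ dom φ) λ h → arr φ ∘ h ≈ ⟨ id , f ⟩
  section-from-functional-part {X} φ L (i , ei) functional (factor k ek) cover =
    π₂ ∘ (arr L ∘ σ) , i ∘ σ , ⟨⟩-unique _ π₁∘φ∘i∘σ≈id (∘-resp-≈ʳ φ∘i∘σ≈L∘σ)
    where
    image≤domain : image (π₁ ∘ arr φ) ≤ domainSub L functional
    image≤domain = proj₂ (image-is (π₁ ∘ arr φ)) (domainSub L functional) (k , ek)
    id∈domain : id ∈ domainSub L functional
    id∈domain = ∈-≤ (IsTop⇒id∈ {S = image (π₁ ∘ arr φ)} cover) image≤domain
    σ : X ⇒ dom L
    σ = _∈_.witness id∈domain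
    φ∘i∘σ≈L∘σ : arr φ ∘ (i ∘ σ) ≈ arr L ∘ σ
    φ∘i∘σ≈L∘σ = trans≈ sym-assoc (∘-resp-≈ˡ ei)
    π₁∘φ∘i∘σ≈id : π₁ ∘ (arr φ ∘ (i ∘ σ)) ≈ id
    π₁∘φ∘i∘σ≈id = trans≈ (∘-resp-≈ʳ φ∘i∘σ≈L∘σ) (trans≈ sym-assoc (_∈_.commutes id∈domain))

module LeastWitness {o ℓ e} (𝒞 : CoherentCategory o ℓ e) where
  open CoherentCategory 𝒞
  open Morphisms 𝒞
  open Elements 𝒞
  open Copairing 𝒞
  open ParametrisedRecursion 𝒞
  open FunctionalRelations 𝒞

  module Search (N : Obj) (z : 𝟙 ⇒ N) (s : N ⇒ N) (pno : IsPNO N z s) (X : Obj)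
      {φ ψ μ J : Sub (X × N)} (isMeet : IsMeet φ ψ μ) (bottom : IsBottom μ)
      (isJoin : IsJoin φ ψ J) (top : IsTop J) where
    open PNO N z s pno

    Y : Obj
    Y = X × N

    ∈J : ∀ {W} (x : W ⇒ Y) → x ∈ J
    ∈J = id∈⇒∈ (IsTop⇒id∈ {S = J} top)

    step-copair : Σ (Y ⇒ Y) λ c → (c ∘ arr φ ≈ arr φ) ×ᵖ (c ∘ arr ψ ≈ next ∘ arr ψ)
    step-copair = copair {φ = φ} {ψ} {μ} {J} isMeet bottom isJoin top (arr φ) (next ∘ arr ψ)

    step : Y ⇒ Y
    step = proj₁ step-copair

    step-φ : ∀ {W} {x : W ⇒ Y} → x ∈ φ → step ∘ x ≈ x
    step-φ {x = x} (factor c ec) = begin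
      step ∘ x              ≈⟨ ∘-resp-≈ʳ (sym≈ ec) ⟩
      step ∘ (arr φ ∘ c)    ≈⟨ sym-assoc ⟩
      (step ∘ arr φ) ∘ c    ≈⟨ ∘-resp-≈ˡ (proj₁ (proj₂ step-copair)) ⟩
      arr φ ∘ c             ≈⟨ ec ⟩
      x                     ∎

    step-ψ : ∀ {W} {x : W ⇒ Y} → x ∈ ψ → step ∘ x ≈ next ∘ x
    step-ψ {x = x} (factor c ec) = begin
      step ∘ x              ≈⟨ ∘-resp-≈ʳ (sym≈ ec) ⟩
      step ∘ (arr ψ ∘ c)    ≈⟨ sym-assoc ⟩
      (step ∘ arr ψ) ∘ c    ≈⟨ ∘-resp-≈ˡ (proj₂ (proj₂ step-copair)) ⟩
      (next ∘ arr ψ) ∘ c    ≈⟨ assoc ⟩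
      next ∘ (arr ψ ∘ c)    ≈⟨ ∘-resp-≈ʳ ec ⟩
      next ∘ x              ∎

    π₁∘step : π₁ ∘ step ≈ π₁
    π₁∘step = join-elim-≈ id φ ψ J isJoin (∈J id) (π₁ ∘ step) π₁
      (λ v v∈φ → trans≈ assoc (∘-resp-≈ʳ (step-φ (∈-resp-≈ identityˡ v∈φ))))
      (λ v v∈ψ → trans≈ assoc (trans≈ (∘-resp-≈ʳ (step-ψ (∈-resp-≈ identityˡ v∈ψ)))
                   (trans≈ sym-assoc (∘-resp-≈ˡ project₁))))

    search : Y ⇒ Y
    search = proj₁ (pno {A = X} start step)

    search-start : search ∘ start ≈ start
    search-start = proj₁ (proj₂ (pno start step))

    search-next : search ∘ next ≈ step ∘ search
    search-next = proj₁ (proj₂ (proj₂ (pno start step)))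

    search-next∘ : ∀ {W} {x : W ⇒ Y} → search ∘ (next ∘ x) ≈ step ∘ (search ∘ x)
    search-next∘ = trans≈ sym-assoc (trans≈ (∘-resp-≈ˡ search-next) assoc)

    π₁∘search : π₁ ∘ search ≈ π₁
    π₁∘search = rec-unique id id (π₁ ∘ search) π₁
      (trans≈ assoc (trans≈ (∘-resp-≈ʳ search-start) project₁))
      (trans≈ assoc (trans≈ (∘-resp-≈ʳ search-next)
        (trans≈ sym-assoc (trans≈ (∘-resp-≈ˡ π₁∘step) (sym≈ identityˡ)))))
      project₁
      (trans≈ project₁ (sym≈ identityˡ))

    Idempotent Stopped Unmoved Invariant : Sub Y
    Idempotent = equaliser (search ∘ search) search
    Stopped = composite Idempotent (pullbackSub (search ∘ arr Idempotent) φ)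
    Unmoved = equaliser search id
    Invariant = join Stopped Unmoved

    Stopped⁺ : ∀ {V} {v : V ⇒ Y} → search ∘ v ∈ φ → search ∘ (search ∘ v) ≈ search ∘ v → v ∈ Stopped
    Stopped⁺ {v = v} found stays =
      composite⁺ Idempotent (pullbackSub (search ∘ arr Idempotent) φ) (_∈_.commutes v∈Idempotent)
        (pullbackSub⁺ (search ∘ arr Idempotent) φ
          (∈-resp-≈ (sym≈ (trans≈ assoc (∘-resp-≈ʳ (_∈_.commutes v∈Idempotent)))) found))
      where
      v∈Idempotent : v ∈ Idempotent
      v∈Idempotent = equaliser⁺ (search ∘ search) search (trans≈ assoc stays)

    Stopped⁻ : ∀ {V} {v : V ⇒ Y} → v ∈ Stopped → (search ∘ v ∈ φ) ×ᵖ (search ∘ (search ∘ v) ≈ search ∘ v)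
    Stopped⁻ {V} {v} (factor q eq) =
      ∈-resp-≈ (trans≈ assoc (∘-resp-≈ʳ Ir≈v)) (pullbackSub⁻ (search ∘ arr Idempotent) φ (factor q refl≈)) ,
      trans≈ sym-assoc (equaliser⁻ (search ∘ search) search (factor r Ir≈v))
      where
      r : V ⇒ dom Idempotent
      r = arr (pullbackSub (search ∘ arr Idempotent) φ) ∘ q
      Ir≈v : arr Idempotent ∘ r ≈ v
      Ir≈v = trans≈ sym-assoc eq

    Unmoved⁺ : ∀ {V} {v : V ⇒ Y} → search ∘ v ≈ v → v ∈ Unmoved
    Unmoved⁺ fixed = equaliser⁺ search id (trans≈ fixed (sym≈ identityˡ))

    Unmoved⁻ : ∀ {V} {v : V ⇒ Y} → v ∈ Unmoved → search ∘ v ≈ v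
    Unmoved⁻ v∈Unmoved = trans≈ (equaliser⁻ search id v∈Unmoved) identityˡ

    Stopped⊆Invariant : ∀ {V} {v : V ⇒ Y} → v ∈ Stopped → v ∈ Invariant
    Stopped⊆Invariant v∈Stopped = ∈-≤ v∈Stopped (proj₁ (join-is Stopped Unmoved))

    Unmoved⊆Invariant : ∀ {V} {v : V ⇒ Y} → v ∈ Unmoved → v ∈ Invariant
    Unmoved⊆Invariant v∈Unmoved = ∈-≤ v∈Unmoved (proj₁ (proj₂ (join-is Stopped Unmoved)))

    Stopped-next : ∀ {V} {v : V ⇒ Y} → v ∈ Stopped → next ∘ v ∈ Stopped
    Stopped-next {v = v} v∈Stopped = Stopped⁺ (∈-resp-≈ (sym≈ no-step) found)
      (trans≈ (∘-resp-≈ʳ no-step) (trans≈ stays (sym≈ no-step)))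
      where
      found : search ∘ v ∈ φ
      found = proj₁ (Stopped⁻ v∈Stopped)
      stays : search ∘ (search ∘ v) ≈ search ∘ v
      stays = proj₂ (Stopped⁻ v∈Stopped)
      no-step : search ∘ (next ∘ v) ≈ search ∘ v
      no-step = trans≈ search-next∘ (step-φ found)

    Unmoved-next : ∀ {V} {v : V ⇒ Y} → v ∈ Unmoved → next ∘ v ∈ Invariant
    Unmoved-next {V} {v} v∈Unmoved = join-elim-∈ v φ ψ J isJoin (∈J v) (next ∘ v) Invariant on-φ on-ψ
      where
      unmoved∘ : ∀ {U} (w : U ⇒ V) → search ∘ (v ∘ w) ≈ v ∘ w
      unmoved∘ w = trans≈ sym-assoc (∘-resp-≈ˡ (Unmoved⁻ v∈Unmoved))

      on-φ : ∀ {U} (w : U ⇒ V) → v ∘ w ∈ φ → (next ∘ v) ∘ w ∈ Invariant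
      on-φ w vw∈φ = ∈-resp-≈ sym-assoc (Stopped⊆Invariant (Stopped⁺ (∈-resp-≈ (sym≈ lands) vw∈φ)
          (trans≈ (∘-resp-≈ʳ lands) (trans≈ (unmoved∘ w) (sym≈ lands)))))
        where
        lands : search ∘ (next ∘ (v ∘ w)) ≈ v ∘ w
        lands = trans≈ search-next∘ (trans≈ (∘-resp-≈ʳ (unmoved∘ w)) (step-φ vw∈φ))

      on-ψ : ∀ {U} (w : U ⇒ V) → v ∘ w ∈ ψ → (next ∘ v) ∘ w ∈ Invariant
      on-ψ w vw∈ψ = ∈-resp-≈ sym-assoc (Unmoved⊆Invariant (Unmoved⁺
        (trans≈ search-next∘ (trans≈ (∘-resp-≈ʳ (unmoved∘ w)) (step-ψ vw∈ψ)))))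

    Invariant-next : next ∘ arr Invariant ∈ Invariant
    Invariant-next = join-elim-∈ (arr Invariant) Stopped Unmoved Invariant (join-is Stopped Unmoved) arr∈
      (next ∘ arr Invariant) Invariant
      (λ w h → ∈-resp-≈ sym-assoc (Stopped⊆Invariant (Stopped-next h)))
      (λ w h → ∈-resp-≈ sym-assoc (Unmoved-next h))

    Invariant-everywhere : id ∈ Invariant
    Invariant-everywhere = induction Invariant (Unmoved⊆Invariant (Unmoved⁺ search-start)) Invariant-next

    Fixed : Sub (dom φ)
    Fixed = equaliser (search ∘ arr φ) (arr φ)

    Least : Sub Y
    Least = composite φ Fixed

    Least⁺ : ∀ {V} {x : V ⇒ Y} → x ∈ φ → search ∘ x ≈ x → x ∈ Least
    Least⁺ {x = x} (factor c ec) fixed = composite⁺ φ Fixed ec (equaliser⁺ (search ∘ arr φ) (arr φ) (begin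
      (search ∘ arr φ) ∘ c  ≈⟨ assoc ⟩
      search ∘ (arr φ ∘ c)  ≈⟨ ∘-resp-≈ʳ ec ⟩
      search ∘ x            ≈⟨ fixed ⟩
      x                     ≈⟨ sym≈ ec ⟩
      arr φ ∘ c             ∎))

    Least⁻ : ∀ {V} {x : V ⇒ Y} → x ∈ Least → (x ∈ φ) ×ᵖ (search ∘ x ≈ x)
    Least⁻ {V} {x} (factor q eq) = factor r φr≈x , (begin
      search ∘ x            ≈⟨ ∘-resp-≈ʳ (sym≈ φr≈x) ⟩
      search ∘ (arr φ ∘ r)  ≈⟨ sym-assoc ⟩
      (search ∘ arr φ) ∘ r  ≈⟨ equaliser⁻ (search ∘ arr φ) (arr φ) (factor q refl≈) ⟩
      arr φ ∘ r             ≈⟨ φr≈x ⟩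
      x                     ∎)
      where
      r : V ⇒ dom φ
      r = arr Fixed ∘ q
      φr≈x : arr φ ∘ r ≈ x
      φr≈x = trans≈ sym-assoc eq

    search∘φ∈Least : search ∘ arr φ ∈ Least
    search∘φ∈Least = join-elim-∈ (arr φ) Stopped Unmoved Invariant (join-is Stopped Unmoved)
      (id∈⇒∈ Invariant-everywhere (arr φ)) (search ∘ arr φ) Least
      (λ w h → ∈-resp-≈ sym-assoc (Least⁺ (proj₁ (Stopped⁻ h)) (proj₂ (Stopped⁻ h))))
      (λ w h → ∈-resp-≈ sym-assoc (Least⁺ (∈-resp-≈ (sym≈ (Unmoved⁻ h)) (factor w refl≈))
                                          (∘-resp-≈ʳ (Unmoved⁻ h))))

    shifted : ∀ {W} → W ⇒ Y → W × N ⇒ Y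
    shifted w = ⟨ (π₁ ∘ w) ∘ π₁ , (π₂ ∘ w) ∘ π₁ ⊕ π₂ ⟩

    shifted-start : ∀ {W} {w : W ⇒ Y} → shifted w ∘ start ≈ w
    shifted-start = trans≈ ∘-distribʳ-⟨⟩ (trans≈ (⟨⟩-cong₂ (trans≈ pullʳ-project₁ identityʳ)
      (trans≈ ⊕-∘ (trans≈ (⊕-cong (trans≈ pullʳ-project₁ identityʳ) project₂) ⊕-identityʳ))) g-η)

    shifted-next : ∀ {W} {w : W ⇒ Y} → shifted w ∘ next ≈ next ∘ shifted w
    shifted-next = trans≈ ∘-distribʳ-⟨⟩ (trans≈ (⟨⟩-cong₂ pullʳ-project₁
      (trans≈ ⊕-∘ (trans≈ (⊕-cong pullʳ-project₁ project₂) ⊕-sucʳ))) (sym≈ next∘⟨⟩))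

    shifted-at : ∀ {W} {w : W ⇒ Y} {k : W ⇒ N} → shifted w ∘ ⟨ id , k ⟩ ≈ ⟨ π₁ ∘ w , π₂ ∘ w ⊕ k ⟩
    shifted-at = trans≈ ∘-distribʳ-⟨⟩ (⟨⟩-cong₂ (trans≈ pullʳ-project₁ identityʳ)
      (trans≈ ⊕-∘ (⊕-cong (trans≈ pullʳ-project₁ identityʳ) project₂)))

    -- search ∘ shifted w and (search ∘ w) ∘ π₁ solve the same recursion, as step fixes search ∘ w ∈ φ.
    search-stuck : ∀ {W} (w : W ⇒ Y) → search ∘ w ∈ φ → (k : W ⇒ N) →
      search ∘ ⟨ π₁ ∘ w , π₂ ∘ w ⊕ k ⟩ ≈ search ∘ w
    search-stuck w found k = begin
      search ∘ ⟨ π₁ ∘ w , π₂ ∘ w ⊕ k ⟩          ≈⟨ ∘-resp-≈ʳ (sym≈ shifted-at) ⟩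
      search ∘ (shifted w ∘ ⟨ id , k ⟩)          ≈⟨ sym-assoc ⟩
      (search ∘ shifted w) ∘ ⟨ id , k ⟩          ≈⟨ ∘-resp-≈ˡ search∘shifted ⟩
      ((search ∘ w) ∘ π₁) ∘ ⟨ id , k ⟩           ≈⟨ pullʳ-project₁ ⟩
      (search ∘ w) ∘ id                          ≈⟨ identityʳ ⟩
      search ∘ w                                 ∎
      where
      search∘shifted : search ∘ shifted w ≈ (search ∘ w) ∘ π₁
      search∘shifted = rec-unique (search ∘ w) step (search ∘ shifted w) ((search ∘ w) ∘ π₁)
        (trans≈ assoc (∘-resp-≈ʳ shifted-start))
        (trans≈ assoc (trans≈ (∘-resp-≈ʳ shifted-next) search-next∘))
        (trans≈ pullʳ-project₁ identityʳ)
        (trans≈ pullʳ-project₁ (sym≈ (step-φ (∈-∘ found π₁))))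

    Least-stuck : ∀ {W} {x : W ⇒ Y} → x ∈ Least → (k : W ⇒ N) → search ∘ ⟨ π₁ ∘ x , π₂ ∘ x ⊕ k ⟩ ≈ x
    Least-stuck {x = x} x∈Least k =
      trans≈ (search-stuck x (∈-resp-≈ (sym≈ fixed) x∈φ) k) fixed
      where
      x∈φ : x ∈ φ
      x∈φ = proj₁ (Least⁻ x∈Least)
      fixed : search ∘ x ≈ x
      fixed = proj₂ (Least⁻ x∈Least)

    Least-functional : Mono (π₁ ∘ arr Least)
    Least-functional {W} u v eq = mono Least u v (begin
      a                                      ≈⟨ sym≈ (Least-stuck (factor u refl≈) (π₂ ∘ b)) ⟩
      search ∘ ⟨ π₁ ∘ a , π₂ ∘ a ⊕ π₂ ∘ b ⟩  ≈⟨ ∘-resp-≈ʳ (⟨⟩-cong₂ same-x (⊕-comm _ _)) ⟩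
      search ∘ ⟨ π₁ ∘ b , π₂ ∘ b ⊕ π₂ ∘ a ⟩  ≈⟨ Least-stuck (factor v refl≈) (π₂ ∘ a) ⟩
      b                                      ∎)
      where
      a b : W ⇒ Y
      a = arr Least ∘ u
      b = arr Least ∘ v
      same-x : π₁ ∘ a ≈ π₁ ∘ b
      same-x = trans≈ sym-assoc (trans≈ eq assoc)

    π₁∘φ∈domain : π₁ ∘ arr φ ∈ domainSub Least Least-functional
    π₁∘φ∈domain = factor k (begin
      (π₁ ∘ arr Least) ∘ k  ≈⟨ assoc ⟩
      π₁ ∘ (arr Least ∘ k)  ≈⟨ ∘-resp-≈ʳ (_∈_.commutes search∘φ∈Least) ⟩
      π₁ ∘ (search ∘ arr φ) ≈⟨ sym-assoc ⟩
      (π₁ ∘ search) ∘ arr φ ≈⟨ ∘-resp-≈ˡ π₁∘search ⟩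
      π₁ ∘ arr φ            ∎)
      where
      k : dom φ ⇒ dom Least
      k = _∈_.witness search∘φ∈Least

    least-witness : topSub X ≤ image (π₁ ∘ arr φ) →
      Σ (X ⇒ N) λ f → Σ (X ⇒ dom φ) λ h → arr φ ∘ h ≈ ⟨ id , f ⟩
    least-witness = section-from-functional-part φ Least (arr Fixed , refl≈) Least-functional π₁∘φ∈domain

corollary2p13 : ∀ {o ℓ e : Level} (𝒞 : CoherentCategory o ℓ e) →
    let open CoherentCategory 𝒞 in
    (N : Obj) (z : 𝟙 ⇒ N) (s : N ⇒ N) → IsPNO N z s →
    (X : Obj) (φ : Sub (X × N)) → Complemented φ →
    topSub X ≤ image (π₁ ∘ arr φ) →
    Σ (X ⇒ N) λ f → Σ (X ⇒ dom φ) λ h → arr φ ∘ h ≈ ⟨ id , f ⟩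
corollary2p13 𝒞 N z s pno X φ (ψ , (μ , isMeet , bottom) , (J , isJoin , top)) =
  Search.least-witness N z s pno X {φ} {ψ} {μ} {J} isMeet bottom isJoin top
  where open LeastWitness 𝒞
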